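{- Let $X$ be a CAT(0) cube complex (for instance the state complex of a reconfigurable system which is CAT(0)), let $a$ and $b$ be vertices of $X$, let $P_a$ be the poset with inconsistent pairs corresponding to the rooted complex $(X,a)$, and let $B$ be the consistent order ideal of $P_a$ corresponding to the vertex $b$, regarded as a subposet of $P_a$. Then the shortest edge-paths from $a$ to $b$ in $X$ are in one-to-one correspondence with the linear extensions of the poset $B$, and their length is $|B|$.
   Context: An edge-path is a path in the 1-skeleton of $X$ (a sequence of vertices, consecutive ones joined by edges), and its length is its number of edges. A poset with inconsistent pairs (PIP) is a locally finite poset $P$ of finite width with a collection of inconsistent pairs $\{p,q\}$ such that inconsistent elements have no common upper bound and inconsistency is inherited upward (if $p,q$ inconsistent and $p'\ge p$, $q'\ge q$ then $p',q'$ inconsistent). The cube complex $X(P)$ has vertices the consistent order ideals of $P$ (order ideals with no inconsistent pair), and a cube $C(I,M)$ of dimension $|M|$ for each consistent order ideal $I$ and subset $M$ of the maximal elements of $I$, with vertices $I\setminus S$, $S\subseteq M$, glued along faces; it is rooted at the empty ideal. By a theorem of Ardila, Owen and Sullivant, rooted CAT(0) cube complexes correspond bijectively to PIPs via $P\mapsto X(P)$; $P_a$ is the PIP with $X(P_a)\cong X$ by an isomorphism sending the empty ideal to $a$, and this isomorphism identifies vertices of $X$ with consistent order ideals of $P_a$. A linear extension of a finite poset $B$ is a total ordering of its elements compatible with its partial order. -}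

module Defs where

open import Level using (Level; suc; Lift)
open import Data.Empty using (⊥)
open import Data.Nat using (ℕ; zero; _≤_; _<_)
open import Data.Nat.Properties using (≤-trans; ≤-reflexive)
open import Data.Fin using (Fin; toℕ)
open import Data.List using (List; length; lookup)
open import Data.List.Membership.Propositional using (_∈_)
open import Data.List.Relation.Unary.Unique.Propositional using (Unique)
open import Data.Product using (Σ; _×_; _,_; proj₁; proj₂)
open import Data.Sum using (_⊎_)
open import Relation.Nullary using (¬_)
open import Relation.Unary using (Pred; _≐_)
open import Relation.Binary using (Rel; IsPartialOrder; Symmetric; Setoid; IsEquivalence)
open import Relation.Binary.PropositionalEquality as PE using (_≡_; _≢_)

record PIP (ℓ : Level) : Set (suc ℓ) where
  field
    Carrier        : Set ℓ
    _≼_            : Rel Carrier ℓ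
    isPartialOrder : IsPartialOrder _≡_ _≼_
    _#_            : Rel Carrier ℓ
    #-sym          : Symmetric _#_
    #-noUB         : ∀ {p q} → p # q → ¬ (Σ Carrier λ r → (p ≼ r) × (q ≼ r))
    #-up           : ∀ {p q p' q'} → p # q → p ≼ p' → q ≼ q' → p' # q'
    locallyFinite  : ∀ p q → Σ (List Carrier) λ xs → ∀ r → p ≼ r → r ≼ q → r ∈ xs
    finiteWidth    : Σ ℕ λ w → ∀ (xs : List Carrier) → Unique xs →
                       (∀ {x y} → x ∈ xs → y ∈ xs → x ≼ y → x ≡ y) → length xs ≤ w

module _ {ℓ : Level} (P : PIP ℓ) where
  open PIP P

  EmptyIdeal : Pred Carrier ℓ
  EmptyIdeal _ = Lift ℓ ⊥

  IsOrderIdeal : Pred Carrier ℓ → Set ℓ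
  IsOrderIdeal I = ∀ {p q} → I q → p ≼ q → I p

  IsConsistent : Pred Carrier ℓ → Set ℓ
  IsConsistent I = ∀ {p q} → I p → I q → ¬ (p # q)

  IsVertex : Pred Carrier ℓ → Set ℓ
  IsVertex I = IsOrderIdeal I × IsConsistent I

  IsMaximalIn : Carrier → Pred Carrier ℓ → Set ℓ
  IsMaximalIn m I = I m × (∀ {q} → I q → m ≼ q → q ≡ m)

  -- J = I ∖ {m} with m maximal in I  (the 1-cube C(I,{m}) joins I and J)
  Removes : Pred Carrier ℓ → Pred Carrier ℓ → Carrier → Set ℓ
  Removes I J m = IsMaximalIn m I × (J ≐ (λ x → I x × x ≢ m))

  Adjacent : Pred Carrier ℓ → Pred Carrier ℓ → Set ℓ
  Adjacent I J = (Σ Carrier λ m → Removes I J m) ⊎ (Σ Carrier λ m → Removes J I m)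

  record EdgePath (I J : Pred Carrier ℓ) : Set (suc ℓ) where
    field
      len      : ℕ
      vert     : ℕ → Pred Carrier ℓ
      isVertex : ∀ i → i ≤ len → IsVertex (vert i)
      start    : vert 0 ≐ I
      end      : vert len ≐ J
      adj      : ∀ i → i < len → Adjacent (vert i) (vert (ℕ.suc i))
  open EdgePath public

  _≈P_ : ∀ {I J} → Rel (EdgePath I J) ℓ
  p ≈P q = (len p ≡ len q) × (∀ i → i ≤ len p → vert p i ≐ vert q i)

  IsShortest : ∀ {I J} → EdgePath I J → Set (suc ℓ)
  IsShortest {I} {J} p = ∀ (q : EdgePath I J) → len p ≤ len q

  ShortestPath : Pred Carrier ℓ → Set (suc ℓ)
  ShortestPath B = Σ (EdgePath EmptyIdeal B) IsShortest

  ShortestPathSetoid : Pred Carrier ℓ → Setoid (suc ℓ) ℓ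
  ShortestPathSetoid B = record
    { Carrier = ShortestPath B
    ; _≈_ = λ p q → proj₁ p ≈P proj₁ q
    ; isEquivalence = record
      { refl = PE.refl , λ i _ → (λ x → x) , (λ x → x)
      ; sym = λ { (e , f) → PE.sym e , λ i i≤ → let (a , b) = f i (≤-trans i≤ (≤-reflexive (PE.sym e))) in b , a }
      ; trans = λ { (e , f) (e' , g) → PE.trans e e' , λ i i≤ →
                  let (a , b) = f i i≤ ; (c , d) = g i (≤-trans i≤ (≤-reflexive e)) in
                  (λ x → c (a x)) , (λ x → b (d x)) }
      }
    }

  FiniteSet : Pred Carrier ℓ → Set ℓ
  FiniteSet B = Σ (List Carrier) λ xs → Unique xs × ((λ x → x ∈ xs) ≐ B)

  card : ∀ {B} → FiniteSet B → ℕ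
  card fin = length (proj₁ fin)

  IsLinearExtension : Pred Carrier ℓ → List Carrier → Set ℓ
  IsLinearExtension B ys =
    Unique ys × ((λ x → x ∈ ys) ≐ B) ×
    (∀ (i j : Fin (length ys)) → lookup ys i ≼ lookup ys j → toℕ i ≤ toℕ j)

  LinearExtension : Pred Carrier ℓ → Set ℓ
  LinearExtension B = Σ (List Carrier) (IsLinearExtension B)

  LinearExtensionSetoid : Pred Carrier ℓ → Setoid ℓ ℓ
  LinearExtensionSetoid B = record
    { Carrier = LinearExtension B
    ; _≈_ = λ s t → proj₁ s ≡ proj₁ t
    ; isEquivalence = record { refl = PE.refl ; sym = PE.sym ; trans = PE.trans }
    }

{-# OPTIONS --safe #-}
-- A vertex of X(P) is a consistent order ideal, and an edge adds or removes a
-- single maximal element. Hence a path from the empty ideal to B adds every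
-- element of B at some step, so it has at least |B| steps, and more if it ever
-- removes an element. Listing B along a linear extension and stepping through
-- its initial segments gives a path with exactly |B| steps. So a shortest path
-- only adds, each element after everything below it: its order of addition is
-- a linear extension, from which the path is recovered as the sequence of
-- initial segments.
--
-- Equality in P and membership in the ideals along a path are undecidable, so
-- the counting is carried out under double negation; its conclusions are
-- inequalities between natural numbers or statements about the finite set B,
-- which are decidable and hence stable.
module Submission where

open import Defs
open import Level using (Level; _⊔_; lift; lower) renaming (suc to lsuc)
open import Relation.Unary using (Pred)
open import Relation.Binary.PropositionalEquality using (_≡_)
open import Data.Product using (_×_; proj₁)
open import Function.Bundles using (Bijection)

open import Function using (_∘_; id)
open import Function.Bundles using (Inverse)
open import Function.Properties.Inverse using (Inverse⇒Bijection)
open import Relation.Unary using (_⊆_; _≐_)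
open import Relation.Binary using (Rel; IsPartialOrder; Setoid; tri<; tri≈; tri>)
open import Relation.Binary.PropositionalEquality using (refl; sym; trans; cong; cong₂; subst; _≢_)
open import Relation.Nullary using (¬_; Dec; yes; no)
open import Relation.Nullary.Negation using (contradiction; ¬¬-map; negated-stable)
open import Relation.Nullary.Decidable using (decidable-stable; ¬¬-excluded-middle; _×-dec_)
open import Data.Empty using (⊥-elim)
open import Data.Product using (Σ; ∃-syntax; _,_; proj₂)
open import Data.Sum using (_⊎_; inj₁; inj₂)
open import Data.Nat using (ℕ; zero; suc; _≤_; _<_; _≤′_; ≤′-refl; ≤′-step; z≤n; s≤s; s≤s⁻¹)
open import Data.Nat.Properties
  using (≤-refl; ≤-trans; ≤-reflexive; ≤-antisym; <⇒≤; ≤-<-trans; m<n⇒m<1+n; ≤∧≢⇒<; ≤⇒≤′; ≤⇒≯;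
         <-irrefl; <-cmp; suc-injective; _≤?_; _<?_)
  renaming (_≟_ to _≟ℕ_)
open import Data.Fin using (Fin; zero; suc; toℕ; fromℕ<)
open import Data.Fin.Properties
  using (toℕ<n; toℕ-fromℕ<; toℕ-injective; fromℕ<-injective; injective⇒≤; any?; ∀-cons)
  renaming (_≟_ to _≟ᶠ_)
open import Data.List using (List; []; _∷_; length; lookup; tabulate)
open import Data.List.Properties using (length-tabulate)
open import Data.List.Membership.Propositional using (_∈_)
open import Data.List.Membership.Propositional.Properties using (∈-lookup; ∈-tabulate⁺; ∈-tabulate⁻)
open import Data.List.Relation.Unary.Any using (index)
open import Data.List.Relation.Unary.Any.Properties using (lookup-index)
open import Data.List.Relation.Unary.All as All using (All; []; _∷_)
open import Data.List.Relation.Unary.AllPairs as AllPairs using (AllPairs; []; _∷_)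
open import Data.List.Relation.Unary.Unique.Propositional using (Unique)
open import Data.List.Relation.Unary.Unique.Propositional.Properties using (tabulate⁺)
open import Data.List.Relation.Binary.Permutation.Propositional using (_↭_; ↭-refl; ↭-sym; ↭-trans; prep; swap)
open import Data.List.Relation.Binary.Permutation.Propositional.Properties using (All-resp-↭; ∈-resp-↭)

-- The library's ¬¬-Monad lives in a single universe level; the binds below
-- cross levels.
_>>=_ : ∀ {a b} {A : Set a} {B : Set b} → ¬ ¬ A → (A → ¬ ¬ B) → ¬ ¬ B
m >>= f = negated-stable (¬¬-map f m)

¬¬-Π-Fin : ∀ {p n} {P : Fin n → Set p} → (∀ k → ¬ ¬ P k) → ¬ ¬ (∀ k → P k)
¬¬-Π-Fin {n = zero}  _ = contradiction λ ()
¬¬-Π-Fin {n = suc n} h = h zero >>= λ p₀ → ¬¬-map (∀-cons p₀) (¬¬-Π-Fin λ k → h (suc k))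

injective-bounded⇒≤ : ∀ {n L} (f : Fin n → ℕ) → (∀ k → f k < L) →
                      (∀ {i j} → f i ≡ f j → i ≡ j) → n ≤ L
injective-bounded⇒≤ f f<L f-injective = injective⇒≤ {f = λ k → fromℕ< (f<L k)}
  λ {i} {j} e → f-injective (fromℕ<-injective (f i) (f j) (f<L i) (f<L j) e)

module _ {a} {A : Set a} where

  lookup-injective : ∀ {xs : List A} → Unique xs → ∀ {i j} → lookup xs i ≡ lookup xs j → i ≡ j
  lookup-injective {_ ∷ _} (_ ∷ _)     {zero}  {zero}  _ = refl
  lookup-injective {_ ∷ _} (x∉xs ∷ _)  {zero}  {suc j} e = ⊥-elim (All.lookup x∉xs (∈-lookup j) e)
  lookup-injective {_ ∷ _} (x∉xs ∷ _)  {suc i} {zero}  e = ⊥-elim (All.lookup x∉xs (∈-lookup i) (sym e))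
  lookup-injective {_ ∷ _} (_ ∷ uxs)   {suc i} {suc j} e = cong suc (lookup-injective uxs e)

  Unique-⊆⇒length-≤ : ∀ {xs ys : List A} → Unique xs → (∀ {x} → x ∈ xs → x ∈ ys) → length xs ≤ length ys
  Unique-⊆⇒length-≤ {xs} {ys} uxs xs⊆ys = injective⇒≤ {f = position} position-injective
    where
    position : Fin (length xs) → Fin (length ys)
    position i = index (xs⊆ys (∈-lookup i))

    position-injective : ∀ {i j} → position i ≡ position j → i ≡ j
    position-injective {i} {j} e = lookup-injective uxs
      (trans (lookup-index (xs⊆ys (∈-lookup i)))
        (trans (cong (lookup ys) e) (sym (lookup-index (xs⊆ys (∈-lookup j))))))

  ∈-≟ : ∀ {xs : List A} → Unique xs → ∀ {x y} → x ∈ xs → y ∈ xs → Dec (x ≡ y)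
  ∈-≟ {xs} uxs x∈ y∈ with index x∈ ≟ᶠ index y∈
  ... | yes e = yes (trans (lookup-index x∈) (trans (cong (lookup xs) e) (sym (lookup-index y∈))))
  ... | no ne = no λ x≡y → ne (lookup-injective uxs
                  (trans (sym (lookup-index x∈)) (trans x≡y (lookup-index y∈))))

  InFirst : List A → ℕ → Pred A a
  InFirst xs i x = Σ (Fin (length xs)) λ k → toℕ k < i × lookup xs k ≡ x

  InFirst⇒∈ : ∀ {xs i x} → InFirst xs i x → x ∈ xs
  InFirst⇒∈ (k , _ , refl) = ∈-lookup k

  ∈⇒InFirst : ∀ {xs x} → x ∈ xs → InFirst xs (length xs) x
  ∈⇒InFirst x∈ = index x∈ , toℕ<n (index x∈) , sym (lookup-index x∈)

  InFirst-∷⁻ : ∀ {y ys i x} → InFirst (y ∷ ys) (suc i) x → y ≡ x ⊎ InFirst ys i x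
  InFirst-∷⁻ (zero  , _        , e) = inj₁ e
  InFirst-∷⁻ (suc k , s≤s k<i  , e) = inj₂ (k , k<i , e)

  InFirst-∷⁺ : ∀ {y ys i x} → InFirst ys i x → InFirst (y ∷ ys) (suc i) x
  InFirst-∷⁺ (k , k<i , e) = suc k , s≤s k<i , e

  InFirst-suc : ∀ {xs : List A} → Unique xs → (k : Fin (length xs)) →
                InFirst xs (toℕ k) ≐ (λ x → InFirst xs (suc (toℕ k)) x × x ≢ lookup xs k)
  InFirst-suc {xs} uxs k = before⇒≢ , ≢⇒before
    where
    before⇒≢ : ∀ {x} → InFirst xs (toℕ k) x → InFirst xs (suc (toℕ k)) x × x ≢ lookup xs k
    before⇒≢ (j , j<k , e) =
      (j , m<n⇒m<1+n j<k , e) , λ x≡ → <-irrefl (cong toℕ (lookup-injective uxs (trans e x≡))) j<k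

    ≢⇒before : ∀ {x} → InFirst xs (suc (toℕ k)) x × x ≢ lookup xs k → InFirst xs (toℕ k) x
    ≢⇒before ((j , j≤k , e) , x≢) with toℕ j ≟ℕ toℕ k
    ... | yes j≡k = ⊥-elim (x≢ (trans (sym e) (cong (lookup xs) (toℕ-injective j≡k))))
    ... | no  j≢k = j , ≤∧≢⇒< (s≤s⁻¹ j≤k) j≢k , e

  InFirst-injective : ∀ {xs ys : List A} → Unique xs → Unique ys → length xs ≡ length ys →
                      (∀ i → i ≤ length xs → InFirst xs i ≐ InFirst ys i) → xs ≡ ys
  InFirst-injective {[]}    {[]}    _ _ _  _ = refl
  InFirst-injective {x ∷ xs} {y ∷ ys} (x∉xs ∷ uxs) (y∉ys ∷ uys) e same =
    cong₂ _∷_ x≡y (InFirst-injective uxs uys (suc-injective e) λ i i≤ →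
      tail-⊆ x∉xs (proj₁ (same (suc i) (s≤s i≤))) x≡y ,
      tail-⊆ y∉ys (proj₂ (same (suc i) (s≤s i≤))) (sym x≡y))
    where
    x≡y : x ≡ y
    x≡y with InFirst-∷⁻ (proj₁ (same 1 (s≤s z≤n)) (zero , s≤s z≤n , refl))
    ... | inj₁ y≡x         = sym y≡x
    ... | inj₂ (_ , () , _)

    tail-⊆ : ∀ {x y xs ys i} → All (x ≢_) xs → InFirst (x ∷ xs) (suc i) ⊆ InFirst (y ∷ ys) (suc i) →
             x ≡ y → InFirst xs i ⊆ InFirst ys i
    tail-⊆ x∉xs sub refl z∈ with InFirst-∷⁻ (sub (InFirst-∷⁺ z∈))
    ... | inj₁ refl = ⊥-elim (All.lookup x∉xs (InFirst⇒∈ z∈) refl)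
    ... | inj₂ z∈′  = z∈′

  InFirst-tabulate⁻ : ∀ {m} {f : Fin m → A} {i x} → InFirst (tabulate f) i x →
                      Σ (Fin m) λ k → toℕ k < i × f k ≡ x
  InFirst-tabulate⁻ {suc m} (zero  , lt       , e) = zero , lt , e
  InFirst-tabulate⁻ {suc m} {f} (suc k , s≤s lt , e) with InFirst-tabulate⁻ {m} {f ∘ suc} (k , lt , e)
  ... | k′ , lt′ , e′ = suc k′ , s≤s lt′ , e′

  InFirst-tabulate⁺ : ∀ {m} {f : Fin m → A} {i x} → (Σ (Fin m) λ k → toℕ k < i × f k ≡ x) →
                      InFirst (tabulate f) i x
  InFirst-tabulate⁺ {suc m} (zero  , lt       , e) = zero , lt , e
  InFirst-tabulate⁺ {suc m} {f} (suc k , s≤s lt , e) with InFirst-tabulate⁺ {m} {f ∘ suc} (k , lt , e)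
  ... | k′ , lt′ , e′ = suc k′ , s≤s lt′ , e′

module _ {a ℓ} {A : Set a} {_≼_ : Rel A ℓ} (≼-po : IsPartialOrder _≡_ _≼_) where
  open IsPartialOrder ≼-po using (reflexive) renaming (antisym to ≼-antisym; trans to ≼-trans)

  TopologicallySorted : List A → Set (a ⊔ ℓ)
  TopologicallySorted = AllPairs λ x y → ¬ y ≼ x

  TopologicallySorted⇒Unique : ∀ {ws} → TopologicallySorted ws → Unique ws
  TopologicallySorted⇒Unique = AllPairs.map λ y⋠x x≡y → y⋠x (reflexive (sym x≡y))

  TopologicallySorted⇒monotone : ∀ {ws} → TopologicallySorted ws →
                                 ∀ i j → lookup ws i ≼ lookup ws j → toℕ i ≤ toℕ j
  TopologicallySorted⇒monotone (_ ∷ _)         zero    _       _ = z≤n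
  TopologicallySorted⇒monotone (y-min ∷ _)     (suc i) zero    h = ⊥-elim (All.lookup y-min (∈-lookup i) h)
  TopologicallySorted⇒monotone (_ ∷ sorted)    (suc i) (suc j) h = s≤s (TopologicallySorted⇒monotone sorted i j h)

  ¬¬-insert : ∀ x {ys} → All (x ≢_) ys → TopologicallySorted ys →
              ¬ ¬ (∃[ ws ] ws ↭ x ∷ ys × TopologicallySorted ws)
  ¬¬-insert x {[]}     _              []             = contradiction (x ∷ [] , ↭-refl , [] ∷ [])
  ¬¬-insert x {y ∷ ys} (x≢y ∷ x∉ys) (y-min ∷ sorted) = ¬¬-excluded-middle >>= λ where
    (yes x≼y) → contradiction (x ∷ y ∷ ys , ↭-refl ,
                  ((λ y≼x → x≢y (≼-antisym x≼y y≼x)) ∷ All.map (λ z⋠y z≼x → z⋠y (≼-trans z≼x x≼y)) y-min) ∷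
                  y-min ∷ sorted)
    (no x⋠y)  → ¬¬-map (λ (ws , ws↭ , ws-sorted) →
                  y ∷ ws , ↭-trans (prep y ws↭) (swap y x ↭-refl) ,
                  All-resp-↭ (↭-sym ws↭) (x⋠y ∷ y-min) ∷ ws-sorted)
                (¬¬-insert x x∉ys sorted)

  ¬¬-topologicallySort : ∀ {zs} → Unique zs → ¬ ¬ (∃[ ws ] ws ↭ zs × TopologicallySorted ws)
  ¬¬-topologicallySort {[]}     []           = contradiction ([] , ↭-refl , [])
  ¬¬-topologicallySort {z ∷ zs} (z∉zs ∷ uzs) = ¬¬-topologicallySort uzs >>= λ (ws , ws↭ , sorted) →
    ¬¬-map (λ (vs , vs↭ , vs-sorted) → vs , ↭-trans vs↭ (prep z ws↭) , vs-sorted)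
           (¬¬-insert z (All-resp-↭ (↭-sym ws↭) z∉zs) sorted)

module _ {ℓ} (P : PIP ℓ) where
  open PIP P

  Removes⇒⊆ : ∀ {I J m} → Removes P I J m → J ⊆ I
  Removes⇒⊆ (_ , J⊆ , _) j = proj₁ (J⊆ j)

  removed∈ : ∀ {I J m} → Removes P I J m → I m
  removed∈ ((m∈I , _) , _) = m∈I

  removed∉ : ∀ {I J m} → Removes P I J m → ¬ J m
  removed∉ (_ , J⊆ , _) m∈J = proj₂ (J⊆ m∈J) refl

  Removes-keeps : ∀ {I J m x} → Removes P I J m → I x → x ≢ m → J x
  Removes-keeps (_ , _ , ⊆J) x∈I x≢m = ⊆J (x∈I , x≢m)

  Removes-unique : ∀ {I J m m′} → Removes P I J m → Removes P I J m′ → ¬ ¬ m ≡ m′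
  Removes-unique r r′ m≢m′ = removed∉ r′ (Removes-keeps r (removed∈ r′) (m≢m′ ∘ sym))

  Removes-asym : ∀ {I J m m′} → Removes P I J m → ¬ Removes P J I m′
  Removes-asym r r′ = removed∉ r′ (Removes⇒⊆ r (removed∈ r′))

  IsOrderIdeal-resp-≐ : ∀ {I J} → I ≐ J → IsOrderIdeal P I → IsOrderIdeal P J
  IsOrderIdeal-resp-≐ (I⊆J , J⊆I) I-ideal q∈J p≼q = I⊆J (I-ideal (J⊆I q∈J) p≼q)

  module _ {B : Pred Carrier ℓ} {ys} (le : IsLinearExtension P B ys) where
    private
      monotone : ∀ i j → lookup ys i ≼ lookup ys j → toℕ i ≤ toℕ j
      monotone = proj₂ (proj₂ le)

    linearExtension⇒InFirst-isOrderIdeal : IsOrderIdeal P B → ∀ i → IsOrderIdeal P (InFirst ys i)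
    linearExtension⇒InFirst-isOrderIdeal B-ideal i {p} (k , k<i , refl) p≼q =
      index p∈ , ≤-<-trans (monotone (index p∈) k (subst (_≼ lookup ys k) (lookup-index p∈) p≼q)) k<i ,
      sym (lookup-index p∈)
      where
      p∈ : p ∈ ys
      p∈ = proj₂ (proj₁ (proj₂ le)) (B-ideal (proj₁ (proj₁ (proj₂ le)) (∈-lookup k)) p≼q)

    lookup-removes : ∀ k → Removes P (InFirst ys (suc (toℕ k))) (InFirst ys (toℕ k)) (lookup ys k)
    lookup-removes k = ((k , ≤-refl , refl) , maximal) , InFirst-suc (proj₁ le) k
      where
      maximal : ∀ {x} → InFirst ys (suc (toℕ k)) x → lookup ys k ≼ x → x ≡ lookup ys k
      maximal (j , j≤k , refl) k≼j =
        cong (lookup ys) (toℕ-injective (≤-antisym (s≤s⁻¹ j≤k) (monotone k j k≼j)))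

  InFirst-isOrderIdeal⇒monotone : ∀ {ys} → Unique ys → (∀ i → i ≤ length ys → IsOrderIdeal P (InFirst ys i)) →
                                  ∀ i j → lookup ys i ≼ lookup ys j → toℕ i ≤ toℕ j
  InFirst-isOrderIdeal⇒monotone uys ideal i j i≼j
    with ideal (suc (toℕ j)) (toℕ<n j) (j , ≤-refl , refl) i≼j
  ... | k , k≤j , e = subst (_≤ toℕ j) (cong toℕ (lookup-injective uys e)) (s≤s⁻¹ k≤j)

module ShortestPaths {ℓ} (P : PIP ℓ) (B : Pred (PIP.Carrier P) ℓ)
                     (B-vertex : IsVertex P B) (finB : FiniteSet P B) where
  open PIP P

  Path : Set (lsuc ℓ)
  Path = EdgePath P (EmptyIdeal P) B

  n : ℕ
  n = card P finB

  elements : List Carrier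
  elements = proj₁ finB

  elements-unique : Unique elements
  elements-unique = proj₁ (proj₂ finB)

  ∈⇒B : ∀ {x} → x ∈ elements → B x
  ∈⇒B = proj₁ (proj₂ (proj₂ finB))

  B⇒∈ : ∀ {x} → B x → x ∈ elements
  B⇒∈ = proj₂ (proj₂ (proj₂ finB))

  _≟B_ : ∀ {x y} → B x → B y → Dec (x ≡ y)
  x∈B ≟B y∈B = ∈-≟ elements-unique (B⇒∈ x∈B) (B⇒∈ y∈B)

  linearExtension-length : ∀ {ys} → IsLinearExtension P B ys → length ys ≡ n
  linearExtension-length (uys , (∈⇒B′ , B⇒∈′) , _) =
    ≤-antisym (Unique-⊆⇒length-≤ uys λ y∈ → B⇒∈ (∈⇒B′ y∈))
              (Unique-⊆⇒length-≤ elements-unique λ x∈ → B⇒∈′ (∈⇒B x∈))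

  ¬¬-linearExtension : ¬ ¬ LinearExtension P B
  ¬¬-linearExtension = ¬¬-map toLinearExtension (¬¬-topologicallySort isPartialOrder elements-unique)
    where
    toLinearExtension : ∃[ ws ] ws ↭ elements × TopologicallySorted isPartialOrder ws → LinearExtension P B
    toLinearExtension (ws , ws↭ , sorted) =
      ws , TopologicallySorted⇒Unique isPartialOrder sorted ,
      ((λ w∈ → ∈⇒B (∈-resp-↭ ws↭ w∈)) , (λ x∈B → ∈-resp-↭ (↭-sym ws↭) (B⇒∈ x∈B))) ,
      TopologicallySorted⇒monotone isPartialOrder sorted

  pathOf : LinearExtension P B → Path
  pathOf (ys , le@(_ , (∈⇒B′ , B⇒∈′) , _)) = record
    { len      = length ys
    ; vert     = InFirst ys
    ; isVertex = λ i _ → linearExtension⇒InFirst-isOrderIdeal P le (proj₁ B-vertex) i ,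
                         λ p∈ q∈ → proj₂ B-vertex (∈⇒B′ (InFirst⇒∈ p∈)) (∈⇒B′ (InFirst⇒∈ q∈))
    ; start    = (λ { (_ , () , _) }) , λ { (lift ()) }
    ; end      = (λ x∈ → ∈⇒B′ (InFirst⇒∈ x∈)) , (λ x∈B → ∈⇒InFirst (B⇒∈′ x∈B))
    ; adj      = λ i i<len → subst (λ t → Adjacent P (InFirst ys t) (InFirst ys (suc t))) (toℕ-fromℕ< i<len)
                                   (inj₂ (_ , lookup-removes P le (fromℕ< i<len)))
    }

  module Steps (q : Path) where
    L : ℕ
    L = len q

    V : ℕ → Pred Carrier ℓ
    V = vert q

    Adds : ℕ → Carrier → Set ℓ
    Adds i b = Removes P (V (suc i)) (V i) b

    AddedBefore : ℕ → Carrier → Set ℓ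
    AddedBefore j b = ∃[ i ] i < j × Adds i b

    addedBefore-suc : ∀ {j b} → AddedBefore j b → AddedBefore (suc j) b
    addedBefore-suc (i , i<j , a) = i , m<n⇒m<1+n i<j , a

    ¬¬-addedBefore : ∀ j → j ≤ L → ∀ {b} → V j b → ¬ ¬ AddedBefore j b
    ¬¬-addedBefore zero    _   v = ⊥-elim (lower (proj₁ (start q) v))
    ¬¬-addedBefore (suc j) j<L {b} v with adj q j j<L
    ... | inj₁ (_ , drop) = ¬¬-map addedBefore-suc (¬¬-addedBefore j (<⇒≤ j<L) (Removes⇒⊆ P drop v))
    ... | inj₂ (m , add)  = ¬¬-excluded-middle >>= λ where
      (yes b≡m) → contradiction (j , ≤-refl , subst (Adds j) (sym b≡m) add)
      (no  b≢m) → ¬¬-map addedBefore-suc (¬¬-addedBefore j (<⇒≤ j<L) (Removes-keeps P add v b≢m))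

    Additions : Set ℓ
    Additions = ∀ k → ∃[ i ] i < L × Adds i (lookup elements k)

    ¬¬-additions : ¬ ¬ Additions
    ¬¬-additions = ¬¬-Π-Fin λ k → ¬¬-addedBefore L ≤-refl (proj₂ (end q) (∈⇒B (∈-lookup k)))

    additions-injective : (F : Additions) → ∀ {k k′} → proj₁ (F k) ≡ proj₁ (F k′) → k ≡ k′
    additions-injective F {k} {k′} e = decidable-stable (k ≟ᶠ k′)
      (¬¬-map (lookup-injective elements-unique)
        (Removes-unique P (proj₂ (proj₂ (F k))) (subst (λ i → Adds i _) (sym e) (proj₂ (proj₂ (F k′))))))

    card≤len : n ≤ L
    card≤len = decidable-stable (n ≤? L) (¬¬-map (λ F →
      injective-bounded⇒≤ (proj₁ ∘ F) (proj₁ ∘ proj₂ ∘ F) (additions-injective F)) ¬¬-additions)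

    drop⇒card<len : ∀ {i m} → i < L → Removes P (V i) (V (suc i)) m → n < L
    drop⇒card<len {i} i<L drop = decidable-stable (n <? L) (¬¬-map (λ F →
      injective-bounded⇒≤ (steps F) (steps<L F) (steps-injective F)) ¬¬-additions)
      where
      steps : Additions → Fin (suc n) → ℕ
      steps F zero    = i
      steps F (suc k) = proj₁ (F k)

      steps<L : ∀ F k → steps F k < L
      steps<L F zero    = i<L
      steps<L F (suc k) = proj₁ (proj₂ (F k))

      steps-injective : ∀ F {k k′} → steps F k ≡ steps F k′ → k ≡ k′
      steps-injective F {zero}  {zero}   _ = refl
      steps-injective F {zero}  {suc k′} e = ⊥-elim (Removes-asym P drop (subst (λ t → Adds t _) (sym e) (proj₂ (proj₂ (F k′)))))
      steps-injective F {suc k} {zero}   e = ⊥-elim (Removes-asym P drop (subst (λ t → Adds t _) e (proj₂ (proj₂ (F k)))))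
      steps-injective F {suc k} {suc k′} e = cong suc (additions-injective F e)

  module Shortest (q : Path) (q-shortest : IsShortest P q) where
    open Steps q

    len≤card : L ≤ n
    len≤card = decidable-stable (L ≤? n) (¬¬-map (λ (ys , le) →
      ≤-trans (q-shortest (pathOf (ys , le))) (≤-reflexive (linearExtension-length le))) ¬¬-linearExtension)

    len≡card : L ≡ n
    len≡card = ≤-antisym len≤card card≤len

    addition : ∀ i → i < L → Σ Carrier (Adds i)
    addition i i<L with adj q i i<L
    ... | inj₁ (_ , drop) = contradiction (drop⇒card<len i<L drop) (≤⇒≯ len≤card)
    ... | inj₂ add        = add

    V-mono : ∀ {i j} → i ≤′ j → j ≤ L → V i ⊆ V j
    V-mono ≤′-refl          _    = id
    V-mono (≤′-step i≤′j) j<L = Removes⇒⊆ P (proj₂ (addition _ j<L)) ∘ V-mono i≤′j (<⇒≤ j<L)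

    V⊆B : ∀ {i} → i ≤ L → V i ⊆ B
    V⊆B i≤L = proj₁ (end q) ∘ V-mono (≤⇒≤′ i≤L) ≤-refl

    elem : Fin L → Carrier
    elem k = proj₁ (addition (toℕ k) (toℕ<n k))

    elem-adds : ∀ k → Adds (toℕ k) (elem k)
    elem-adds k = proj₂ (addition (toℕ k) (toℕ<n k))

    elem∈B : ∀ k → B (elem k)
    elem∈B k = V⊆B (toℕ<n k) (removed∈ P (elem-adds k))

    elem-≢ : ∀ {i j} → toℕ i < toℕ j → elem i ≢ elem j
    elem-≢ {i} {j} i<j e = removed∉ P (elem-adds j)
      (subst (V (toℕ j)) e (V-mono (≤⇒≤′ i<j) (<⇒≤ (toℕ<n j)) (removed∈ P (elem-adds i))))

    elem-injective : ∀ {i j} → elem i ≡ elem j → i ≡ j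
    elem-injective {i} {j} e with <-cmp (toℕ i) (toℕ j)
    ... | tri< i<j _ _ = ⊥-elim (elem-≢ i<j e)
    ... | tri≈ _ i≡j _ = toℕ-injective i≡j
    ... | tri> _ _ j<i = ⊥-elim (elem-≢ j<i (sym e))

    V⇒elem : ∀ {i} → i ≤ L → ∀ {x} → V i x → Σ (Fin L) λ k → toℕ k < i × elem k ≡ x
    -- Both x and every elem k lie in B, where equality is decidable.
    V⇒elem {i} i≤L {x} v =
      decidable-stable (any? λ k → (toℕ k <? i) ×-dec (elem∈B k ≟B V⊆B i≤L v))
        (¬¬-addedBefore i i≤L v >>= λ (j , j<i , adds) →
          let j<L = ≤-trans j<i i≤L
              j≡k = sym (toℕ-fromℕ< j<L)
          in ¬¬-map (λ e → fromℕ< j<L , subst (_< i) j≡k j<i , e)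
                    (Removes-unique P (elem-adds (fromℕ< j<L)) (subst (λ t → Adds t x) j≡k adds)))

    elem⇒V : ∀ {i} → i ≤ L → ∀ {x} → (Σ (Fin L) λ k → toℕ k < i × elem k ≡ x) → V i x
    elem⇒V i≤L (k , k<i , refl) = V-mono (≤⇒≤′ k<i) i≤L (removed∈ P (elem-adds k))

    order : List Carrier
    order = tabulate elem

    V≐InFirst : ∀ {i} → i ≤ L → V i ≐ InFirst order i
    V≐InFirst i≤L = InFirst-tabulate⁺ ∘ V⇒elem i≤L , elem⇒V i≤L ∘ InFirst-tabulate⁻

    order-isLinearExtension : IsLinearExtension P B order
    order-isLinearExtension =
      order-unique , (order⊆B , B⊆order) , InFirst-isOrderIdeal⇒monotone P order-unique InFirst-isOrderIdeal
      where
      order-unique : Unique order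
      order-unique = tabulate⁺ elem-injective

      order⊆B : ∀ {x} → x ∈ order → B x
      order⊆B x∈ with ∈-tabulate⁻ x∈
      ... | k , refl = elem∈B k

      B⊆order : ∀ {x} → B x → x ∈ order
      B⊆order x∈B with V⇒elem ≤-refl (proj₂ (end q) x∈B)
      ... | k , _ , refl = ∈-tabulate⁺ k

      InFirst-isOrderIdeal : ∀ i → i ≤ length order → IsOrderIdeal P (InFirst order i)
      InFirst-isOrderIdeal i i≤ = IsOrderIdeal-resp-≐ P (V≐InFirst i≤L) (proj₁ (isVertex q i i≤L))
        where
        i≤L : i ≤ L
        i≤L = subst (i ≤_) (length-tabulate elem) i≤

    extension : LinearExtension P B
    extension = order , order-isLinearExtension

    ≈pathOf-extension : _≈P_ P q (pathOf extension)
    ≈pathOf-extension = sym (length-tabulate elem) , λ i i≤L → V≐InFirst i≤L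

  shortestPathOf : LinearExtension P B → ShortestPath P B
  shortestPathOf (ys , le) = pathOf (ys , le) , λ q →
    ≤-trans (≤-reflexive (linearExtension-length le)) (Steps.card≤len q)

  extensionOf : ShortestPath P B → LinearExtension P B
  extensionOf (q , q-shortest) = Shortest.extension q q-shortest

  ≈pathOf-unique : ∀ {q e e′} → _≈P_ P q (pathOf e) → _≈P_ P q (pathOf e′) → proj₁ e ≡ proj₁ e′
  ≈pathOf-unique {e = _ , uys , _} {e′ = _ , uzs , _} (q≡ys , q≐ys) (q≡zs , q≐zs) =
    InFirst-injective uys uzs (trans (sym q≡ys) q≡zs) λ i i≤ →
      let i≤L = subst (i ≤_) (sym q≡ys) i≤
      in proj₁ (q≐zs i i≤L) ∘ proj₂ (q≐ys i i≤L) , proj₁ (q≐ys i i≤L) ∘ proj₂ (q≐zs i i≤L)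

  open Setoid (ShortestPathSetoid P B) using (_≈_) renaming (sym to ≈-sym; trans to ≈-trans)

  ≈shortestPathOf-extensionOf : ∀ p → p ≈ shortestPathOf (extensionOf p)
  ≈shortestPathOf-extensionOf (q , q-shortest) = Shortest.≈pathOf-extension q q-shortest

  shortestPathOf-cong : ∀ {e e′} → proj₁ e ≡ proj₁ e′ → shortestPathOf e ≈ shortestPathOf e′
  shortestPathOf-cong {_ , _} {_ , _} refl = refl , λ _ _ → id , id

  extensionOf-inverseˡ : ∀ {e p} → p ≈ shortestPathOf e → proj₁ (extensionOf p) ≡ proj₁ e
  extensionOf-inverseˡ {e} {p} p≈ = ≈pathOf-unique {proj₁ p} {extensionOf p} {e} (≈shortestPathOf-extensionOf p) p≈

  extensionOf-cong : ∀ {p p′} → p ≈ p′ → proj₁ (extensionOf p) ≡ proj₁ (extensionOf p′)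
  extensionOf-cong {p} {p′} p≈p′ = extensionOf-inverseˡ {extensionOf p′} {p}
    (≈-trans {p} {p′} {shortestPathOf (extensionOf p′)} p≈p′ (≈shortestPathOf-extensionOf p′))

  shortestPathOf-inverseʳ : ∀ {p e} → proj₁ e ≡ proj₁ (extensionOf p) → shortestPathOf e ≈ p
  shortestPathOf-inverseʳ {p} {_ , _} refl = ≈-sym {p} {shortestPathOf (extensionOf p)} (≈shortestPathOf-extensionOf p)

  shortestPaths↔linearExtensions : Inverse (ShortestPathSetoid P B) (LinearExtensionSetoid P B)
  shortestPaths↔linearExtensions = record
    { to        = extensionOf
    ; from      = shortestPathOf
    ; to-cong   = λ {p} {p′} → extensionOf-cong {p} {p′}
    ; from-cong = λ {e} {e′} → shortestPathOf-cong {e} {e′}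
    ; inverse   = (λ {e} {p} → extensionOf-inverseˡ {e} {p}) , λ {p} {e} → shortestPathOf-inverseʳ {p} {e}
    }

proposition7p4 : ∀ {ℓ : Level} (P : PIP ℓ) (B : Pred (PIP.Carrier P) ℓ) →
    IsVertex P B → (finB : FiniteSet P B) →
    Bijection (ShortestPathSetoid P B) (LinearExtensionSetoid P B) ×
    (∀ (p : ShortestPath P B) → EdgePath.len (proj₁ p) ≡ card P finB)
proposition7p4 P B B-vertex finB =
  Inverse⇒Bijection shortestPaths↔linearExtensions , λ (q , q-shortest) → Shortest.len≡card q q-shortest
  where open ShortestPaths P B B-vertex finB
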